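{- For each $n\ge 1$ fix a regular tournament $T_n$ on $2n+1$ vertices. For a directed acyclic graph $G$ with vertex set $\{u_1,\dots,u_n\}$, let $G^\star$ be the oriented graph obtained from the disjoint union of two copies $G^L$ (vertices $u_1^L,\dots,u_n^L$) and $G^R$ (vertices $u_1^R,\dots,u_n^R$) of $G$ and a copy of $T_n$ by adding the arcs: $u_i^Lu_i^R$ for all $1\le i\le n$; $u_j^Ru_k^L$ for all $1\le j,k\le n$ with $j\ne k$; $u_i^Lt$ for all $t\in V(T_n)$ and $1\le i\le n$; and $tu_i^R$ for all $t\in V(T_n)$ and $1\le i\le n$. Then for directed acyclic graphs $G$ and $H$, $G\cong H$ if and only if $G^\star\cong H^\star$.
   Context: A regular tournament is an orientation of a complete graph in which every vertex has the same out-degree. Isomorphism means isomorphism of directed graphs. -}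

module Defs where

open import Data.Nat using (ℕ; zero; suc; _+_; _*_; _≤_)
open import Data.Fin using (Fin) renaming (_≟_ to _≟F_)
open import Data.Bool using (Bool; true; false; not; if_then_else_)
open import Data.List using (List; map; allFin)
open import Data.Nat.ListAction using (sum)
open import Data.Sum using (_⊎_; inj₁; inj₂)
open import Data.Product using (Σ; ∃; _×_)
open import Relation.Nullary using (¬_)
open import Relation.Nullary.Decidable using (⌊_⌋)
open import Relation.Binary.PropositionalEquality using (_≡_; _≢_)
open import Relation.Binary.Construct.Closure.Transitive using (TransClosure)
open import Function.Bundles using (_↔_; Inverse)

Digraph : Set → Set
Digraph V = V → V → Bool

Arc : {V : Set} → Digraph V → V → V → Set
Arc G x y = G x y ≡ true

IsDAG : {V : Set} → Digraph V → Set
IsDAG {V} G = ∀ (x : V) → ¬ TransClosure (Arc G) x x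

outDeg : {k : ℕ} → Digraph (Fin k) → Fin k → ℕ
outDeg {k} G x = sum (map (λ y → if G x y then 1 else 0) (allFin k))

IsTournament : {k : ℕ} → Digraph (Fin k) → Set
IsTournament {k} T =
  (∀ x → T x x ≡ false) ×
  (∀ x y → x ≢ y →
     (T x y ≡ true × T y x ≡ false) ⊎ (T x y ≡ false × T y x ≡ true))

IsRegularTournament : {k : ℕ} → Digraph (Fin k) → Set
IsRegularTournament {k} T =
  IsTournament T × (∃ λ d → ∀ (x : Fin k) → outDeg T x ≡ d)

_≅_ : {V W : Set} → Digraph V → Digraph W → Set
_≅_ {V} {W} G H =
  Σ (V ↔ W) λ f → ∀ x y → G x y ≡ H (Inverse.to f x) (Inverse.to f y)

data StarV (n : ℕ) : Set where
  L : Fin n → StarV n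
  R : Fin n → StarV n
  Tv : Fin (suc (2 * n)) → StarV n

star : {n : ℕ} → Digraph (Fin (suc (2 * n))) → Digraph (Fin n) → Digraph (StarV n)
star Tn G (L i)  (L j)  = G i j
star Tn G (R i)  (R j)  = G i j
star Tn G (Tv s) (Tv t) = Tn s t
star Tn G (L i)  (R j)  = ⌊ i ≟F j ⌋
star Tn G (R j)  (L k)  = not ⌊ j ≟F k ⌋
star Tn G (L i)  (Tv t) = true
star Tn G (Tv t) (R i)  = true
star Tn G (R i)  (Tv t) = false
star Tn G (Tv t) (L i)  = false

-- The out-degree of a vertex of G⋆ tells which part it lies in: every u_i^L
-- dominates all 2n+1 vertices of T_n, so its out-degree exceeds 2n; each
-- vertex of T_n has out-degree n inside the regular tournament T_n plus n
-- towards the right copy, i.e. exactly 2n; and u_j^R has at most n out-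
-- neighbours in G^R and n − 1 in G^L, i.e. fewer than 2n. An isomorphism
-- G⋆ ≅ H⋆ preserves out-degrees, so it maps the left copy of G onto the left
-- copy of H, and restricts to an isomorphism G ≅ H (the numbers of vertices
-- agree since G⋆ has 4n+1 vertices).
module Submission where

open import Defs
open import Data.Nat using (ℕ; zero; suc; _+_; _*_; _≤_; _<_; z≤n; s≤s)
open import Data.Nat.Properties
  using (+-0-commutativeMonoid; +-assoc; +-identityʳ; *-identityʳ; *-cancelˡ-≡;
         suc-injective; n<1+n; m≤n+m; +-mono-≤; +-monoʳ-≤; +-monoˡ-<; <-irrefl; <-asym;
         module ≤-Reasoning)
open import Data.Nat.Tactic.RingSolver using (solve-∀)
open import Data.Nat.ListAction as List using ()
open import Algebra.Properties.CommutativeMonoid.Sum +-0-commutativeMonoid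
  using (sum; sum-cong-≗; sum-replicate-zero; ∑-comm; ∑-distrib-+; sum-permute)
open import Data.Fin using (Fin; zero; suc; _↑ˡ_; _↑ʳ_) renaming (_≟_ to _≟F_)
open import Data.Fin.Properties using (+↔⊎; splitAt-↑ˡ; splitAt-↑ʳ)
  renaming (suc-injective to Fin-suc-injective)
open import Data.Fin.Permutation using (↔⇒≡)
open import Data.Bool using (Bool; true; false; not; if_then_else_)
open import Data.List using (tabulate)
open import Data.List.Properties using (map-tabulate)
open import Data.Sum using (_⊎_; inj₁; inj₂)
open import Data.Sum.Function.Propositional using (_⊎-↔_)
open import Data.Product using (Σ; ∃; _,_; proj₁; proj₂)
open import Data.Empty using (⊥-elim)
open import Function using (_∘_)
open import Function.Bundles using (_↔_; Inverse; Injection; _⇔_; mk↔ₛ′; mk⇔)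
open import Function.Construct.Composition using (_↔-∘_)
open import Function.Construct.Symmetry using (↔-sym)
open import Function.Construct.Identity using (↔-id)
open import Function.Definitions using (Injective)
open import Function.Properties.Inverse using (Inverse⇒Injection)
open import Relation.Nullary using (yes; no)
open import Relation.Nullary.Decidable using (⌊_⌋; isYes≗does; dec-true; dec-false)
open import Relation.Binary.PropositionalEquality

open Inverse using (to; from; strictlyInverseˡ; strictlyInverseʳ)

private
  variable
    k k′ a c : ℕ
    A B V W : Set

𝟙 : Bool → ℕ
𝟙 c = if c then 1 else 0

𝟙≤1 : ∀ b → 𝟙 b ≤ 1
𝟙≤1 true  = s≤s z≤n
𝟙≤1 false = z≤n

sum-const : ∀ k c → sum {k} (λ _ → c) ≡ k * c
sum-const zero    c = refl
sum-const (suc k) c = cong (c +_) (sum-const k c)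

sum-≤-card : (f : Fin k → ℕ) → (∀ i → f i ≤ 1) → sum f ≤ k
sum-≤-card {zero}  f f≤1 = z≤n
sum-≤-card {suc k} f f≤1 = +-mono-≤ (f≤1 zero) (sum-≤-card (f ∘ suc) (f≤1 ∘ suc))

sum-all-but-one : (f : Fin k → ℕ) (j : Fin k) →
                  f j ≡ 0 → (∀ i → i ≢ j → f i ≡ 1) → suc (sum f) ≡ k
sum-all-but-one {suc k} f zero fj≡0 fi≡1 rewrite fj≡0 =
  cong suc (trans (sum-cong-≗ (λ i → fi≡1 (suc i) (λ ())))
                  (trans (sum-const k 1) (*-identityʳ k)))
sum-all-but-one {suc k} f (suc j) fj≡0 fi≡1 rewrite fi≡1 zero (λ ()) =
  cong suc (sum-all-but-one (f ∘ suc) j fj≡0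
                            (λ i i≢j → fi≡1 (suc i) (i≢j ∘ Fin-suc-injective)))

List-sum-tabulate : (h : Fin k → ℕ) → List.sum (tabulate h) ≡ sum h
List-sum-tabulate {zero}  h = refl
List-sum-tabulate {suc k} h = cong (h zero +_) (List-sum-tabulate (h ∘ suc))

outDeg≡∑ : (G : Digraph (Fin k)) (x : Fin k) → outDeg G x ≡ sum (λ y → 𝟙 (G x y))
outDeg≡∑ G x =
  trans (cong List.sum (map-tabulate (λ y → y) (𝟙 ∘ G x))) (List-sum-tabulate (𝟙 ∘ G x))

tournament-row : {T : Digraph (Fin k)} → IsTournament T →
                 ∀ x → suc (sum (λ y → 𝟙 (T x y) + 𝟙 (T y x))) ≡ k
tournament-row {T = T} (irreflexive , one-arc) x =
  sum-all-but-one _ x (cong (λ b → 𝟙 b + 𝟙 b) (irreflexive x)) one-arc-count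
  where
  one-arc-count : ∀ y → y ≢ x → 𝟙 (T x y) + 𝟙 (T y x) ≡ 1
  one-arc-count y y≢x with one-arc x y (y≢x ∘ sym)
  ... | inj₁ (xy , yx) rewrite xy | yx = refl
  ... | inj₂ (xy , yx) rewrite xy | yx = refl

regular-tournament-outDeg : ∀ {m} {T : Digraph (Fin (suc m))} →
                            IsRegularTournament T → ∀ x → 2 * outDeg T x ≡ m
regular-tournament-outDeg {m} {T} (tournament , d , outDeg≡d) x =
  trans (cong (2 *_) (outDeg≡d x)) (*-cancelˡ-≡ (2 * d) m (suc m) handshake)
  where
  open ≡-Reasoning
  row-sum : sum (λ x → sum (λ y → 𝟙 (T x y))) ≡ suc m * d
  row-sum = trans (sum-cong-≗ (λ x → trans (sym (outDeg≡∑ T x)) (outDeg≡d x)))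
                  (sum-const (suc m) d)

  double : ∀ x y → x * (2 * y) ≡ x * y + x * y
  double = solve-∀

  handshake : suc m * (2 * d) ≡ suc m * m
  handshake = begin
    suc m * (2 * d)
      ≡⟨ double (suc m) d ⟩
    suc m * d + suc m * d
      ≡⟨ cong₂ _+_ row-sum row-sum ⟨
    sum (λ x → sum (𝟙 ∘ T x)) + sum (λ y → sum (λ x → 𝟙 (T y x)))
      ≡⟨ cong (sum (λ x → sum (𝟙 ∘ T x)) +_) (∑-comm (λ x y → 𝟙 (T y x))) ⟨
    sum (λ x → sum (𝟙 ∘ T x)) + sum (λ x → sum (λ y → 𝟙 (T y x)))
      ≡⟨ ∑-distrib-+ (λ x → sum (𝟙 ∘ T x)) (λ x → sum (λ y → 𝟙 (T y x))) ⟨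
    sum (λ x → sum (𝟙 ∘ T x) + sum (λ y → 𝟙 (T y x)))
      ≡⟨ sum-cong-≗ (λ x → ∑-distrib-+ (𝟙 ∘ T x) (λ y → 𝟙 (T y x))) ⟨
    sum (λ x → sum (λ y → 𝟙 (T x y) + 𝟙 (T y x)))
      ≡⟨ sum-cong-≗ (λ x → suc-injective (tournament-row tournament x)) ⟩
    sum {suc m} (λ _ → m)
      ≡⟨ sum-const (suc m) m ⟩
    suc m * m ∎

sum-↑ : ∀ a (f : Fin (a + c) → ℕ) → sum f ≡ sum (f ∘ (_↑ˡ c)) + sum (f ∘ (a ↑ʳ_))
sum-↑ zero    f = refl
sum-↑ (suc a) f = trans (cong (f zero +_) (sum-↑ a (f ∘ suc))) (sym (+-assoc (f zero) _ _))

sumOver : Fin k ↔ V → (V → ℕ) → ℕ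
sumOver e p = sum (p ∘ to e)

sumOver-↔ : (e : Fin k ↔ V) (e′ : Fin k′ ↔ W) (F : V ↔ W) (p : W → ℕ) →
            sumOver e′ p ≡ sumOver e (p ∘ to F)
sumOver-↔ e e′ F p = begin
  sum (p ∘ to e′)
    ≡⟨ sum-permute (p ∘ to e′) (↔-sym e′ ↔-∘ (F ↔-∘ e)) ⟩
  sum (p ∘ to e′ ∘ from e′ ∘ to F ∘ to e)
    ≡⟨ sum-cong-≗ (λ i → cong p (strictlyInverseˡ e′ (to F (to e i)))) ⟩
  sum (p ∘ to F ∘ to e) ∎
  where open ≡-Reasoning

_⊕_ : Fin a ↔ A → Fin c ↔ B → Fin (a + c) ↔ (A ⊎ B)
e₁ ⊕ e₂ = (e₁ ⊎-↔ e₂) ↔-∘ +↔⊎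

sumOver-⊕ : (e₁ : Fin a ↔ A) (e₂ : Fin c ↔ B) (p : A ⊎ B → ℕ) →
            sumOver (e₁ ⊕ e₂) p ≡ sumOver e₁ (p ∘ inj₁) + sumOver e₂ (p ∘ inj₂)
sumOver-⊕ {a} {c = c} e₁ e₂ p = trans (sum-↑ a (p ∘ to (e₁ ⊕ e₂)))
  (cong₂ _+_ (sum-cong-≗ (λ i → cong (p ∘ to (e₁ ⊎-↔ e₂)) (splitAt-↑ˡ a i c)))
             (sum-cong-≗ (λ i → cong (p ∘ to (e₁ ⊎-↔ e₂)) (splitAt-↑ʳ a c i))))

outDegree : Fin k ↔ V → Digraph V → V → ℕ
outDegree e G x = sumOver e (𝟙 ∘ G x)

outDegree-≅ : (e : Fin k ↔ V) (e′ : Fin k′ ↔ W) {G : Digraph V} {H : Digraph W} →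
              (iso : G ≅ H) → ∀ x → outDegree e′ H (to (proj₁ iso) x) ≡ outDegree e G x
outDegree-≅ e e′ {H = H} (F , hom) x =
  trans (sumOver-↔ e e′ F (𝟙 ∘ H (to F x)))
        (sum-cong-≗ (λ i → cong 𝟙 (sym (hom x (to e i)))))

≅-sym : {G : Digraph V} {H : Digraph W} → G ≅ H → H ≅ G
≅-sym {H = H} (F , hom) = ↔-sym F , λ x y →
  sym (trans (hom (from F x) (from F y))
             (cong₂ H (strictlyInverseˡ F x) (strictlyInverseˡ F y)))

↔-restrict : (F : V ↔ W) (ι : A → V) (κ : B → W) →
             Injective _≡_ _≡_ ι → Injective _≡_ _≡_ κ →
             (∀ a → ∃ λ b → to F (ι a) ≡ κ b) →
             (∀ b → ∃ λ a → from F (κ b) ≡ ι a) →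
             Σ (A ↔ B) λ F′ → ∀ a → to F (ι a) ≡ κ (to F′ a)
↔-restrict F ι κ ι-inj κ-inj F[ι] F⁻¹[κ] =
  mk↔ₛ′ f g (κ-inj ∘ f∘g) (ι-inj ∘ g∘f) , proj₂ ∘ F[ι]
  where
  open ≡-Reasoning
  f = proj₁ ∘ F[ι]
  g = proj₁ ∘ F⁻¹[κ]

  f∘g : ∀ b → κ (f (g b)) ≡ κ b
  f∘g b = begin
    κ (f (g b))        ≡⟨ proj₂ (F[ι] (g b)) ⟨
    to F (ι (g b))     ≡⟨ cong (to F) (proj₂ (F⁻¹[κ] b)) ⟨
    to F (from F (κ b)) ≡⟨ strictlyInverseˡ F (κ b) ⟩
    κ b                ∎

  g∘f : ∀ a → ι (g (f a)) ≡ ι a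
  g∘f a = begin
    ι (g (f a))        ≡⟨ proj₂ (F⁻¹[κ] (f a)) ⟨
    from F (κ (f a))   ≡⟨ cong (from F) (proj₂ (F[ι] a)) ⟨
    from F (to F (ι a)) ≡⟨ strictlyInverseʳ F (ι a) ⟩
    ι a                ∎

⌊≟⌋-↔ : ∀ {n m} (φ : Fin n ↔ Fin m) i j → ⌊ i ≟F j ⌋ ≡ ⌊ to φ i ≟F to φ j ⌋
⌊≟⌋-↔ φ i j with i ≟F j | to φ i ≟F to φ j
... | yes _   | yes _     = refl
... | no _    | no _      = refl
... | yes i≡j | no φi≢φj  = ⊥-elim (φi≢φj (cong (to φ) i≡j))
... | no i≢j  | yes φi≡φj = ⊥-elim (i≢j (Injection.injective (Inverse⇒Injection φ) φi≡φj))

StarV↔⊎ : ∀ {n} → (Fin n ⊎ (Fin n ⊎ Fin (suc (2 * n)))) ↔ StarV n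
StarV↔⊎ = mk↔ₛ′ join split join∘split split∘join
  where
  join : ∀ {n} → Fin n ⊎ (Fin n ⊎ Fin (suc (2 * n))) → StarV n
  join (inj₁ a)        = L a
  join (inj₂ (inj₁ a)) = R a
  join (inj₂ (inj₂ t)) = Tv t

  split : ∀ {n} → StarV n → Fin n ⊎ (Fin n ⊎ Fin (suc (2 * n)))
  split (L a)  = inj₁ a
  split (R a)  = inj₂ (inj₁ a)
  split (Tv t) = inj₂ (inj₂ t)

  join∘split : ∀ {n} (x : StarV n) → join (split x) ≡ x
  join∘split (L a)  = refl
  join∘split (R a)  = refl
  join∘split (Tv t) = refl

  split∘join : ∀ {n} (s : Fin n ⊎ (Fin n ⊎ Fin (suc (2 * n)))) → split (join s) ≡ s
  split∘join (inj₁ a)        = refl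
  split∘join (inj₂ (inj₁ a)) = refl
  split∘join (inj₂ (inj₂ t)) = refl

L-injective : ∀ {n} → Injective _≡_ _≡_ (L {n})
L-injective refl = refl

starSize : ℕ → ℕ
starSize n = n + (n + suc (2 * n))

starSize-injective : ∀ {n m} → starSize n ≡ starSize m → n ≡ m
starSize-injective {n} {m} eq =
  *-cancelˡ-≡ n m 4 (suc-injective (trans (sym (starSize≡ n)) (trans eq (starSize≡ m))))
  where
  starSize≡ : ∀ n → n + (n + suc (2 * n)) ≡ suc (4 * n)
  starSize≡ = solve-∀

enumStarV : ∀ n → Fin (starSize n) ↔ StarV n
enumStarV n = StarV↔⊎ ↔-∘ (↔-id _ ⊕ (↔-id _ ⊕ ↔-id _))

sumOver-StarV : ∀ {n} (p : StarV n → ℕ) →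
                sumOver (enumStarV n) p ≡ sum (p ∘ L) + (sum (p ∘ R) + sum (p ∘ Tv))
sumOver-StarV p =
  trans (sumOver-⊕ (↔-id _) (↔-id _ ⊕ ↔-id _) (p ∘ to StarV↔⊎))
        (cong (sum (p ∘ L) +_) (sumOver-⊕ (↔-id _) (↔-id _) (p ∘ to StarV↔⊎ ∘ inj₂)))

starOutDeg : ∀ {n} → Digraph (Fin (suc (2 * n))) → Digraph (Fin n) → StarV n → ℕ
starOutDeg {n} Tn G = outDegree (enumStarV n) (star Tn G)

module _ {n} (Tn : Digraph (Fin (suc (2 * n)))) (G : Digraph (Fin n)) where

  starOutDeg-L : ∀ i → 2 * n < starOutDeg Tn G (L i)
  starOutDeg-L i = begin-strict
    2 * n
      <⟨ n<1+n (2 * n) ⟩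
    suc (2 * n)
      ≡⟨ trans (sum-const (suc (2 * n)) 1) (*-identityʳ (suc (2 * n))) ⟨
    sum {suc (2 * n)} (λ _ → 1)
      ≤⟨ m≤n+m _ (sum (λ a → 𝟙 ⌊ i ≟F a ⌋)) ⟩
    sum (λ a → 𝟙 ⌊ i ≟F a ⌋) + sum {suc (2 * n)} (λ _ → 1)
      ≤⟨ m≤n+m _ (sum (𝟙 ∘ G i)) ⟩
    sum (𝟙 ∘ G i) + (sum (λ a → 𝟙 ⌊ i ≟F a ⌋) + sum {suc (2 * n)} (λ _ → 1))
      ≡⟨ sumOver-StarV (𝟙 ∘ star Tn G (L i)) ⟨
    starOutDeg Tn G (L i) ∎
    where open ≤-Reasoning

  starOutDeg-R : ∀ j → starOutDeg Tn G (R j) < 2 * n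
  starOutDeg-R j = begin-strict
    starOutDeg Tn G (R j)
      ≡⟨ sumOver-StarV (𝟙 ∘ star Tn G (R j)) ⟩
    others + (sum (𝟙 ∘ G j) + sum {suc (2 * n)} (λ _ → 0))
      ≡⟨ cong (λ z → others + (sum (𝟙 ∘ G j) + z)) (sum-replicate-zero (suc (2 * n))) ⟩
    others + (sum (𝟙 ∘ G j) + 0)
      ≡⟨ cong (others +_) (+-identityʳ (sum (𝟙 ∘ G j))) ⟩
    others + sum (𝟙 ∘ G j)
      <⟨ +-monoˡ-< (sum (𝟙 ∘ G j)) (n<1+n others) ⟩
    suc others + sum (𝟙 ∘ G j)
      ≡⟨ cong (_+ sum (𝟙 ∘ G j)) others-count ⟩
    n + sum (𝟙 ∘ G j)
      ≤⟨ +-monoʳ-≤ n (sum-≤-card (𝟙 ∘ G j) (𝟙≤1 ∘ G j)) ⟩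
    n + n
      ≡⟨ cong (n +_) (+-identityʳ n) ⟨
    2 * n ∎
    where
    open ≤-Reasoning
    others = sum (λ a → 𝟙 (not ⌊ j ≟F a ⌋))

    others-count : suc others ≡ n
    others-count = sum-all-but-one _ j
      (cong (𝟙 ∘ not) (trans (isYes≗does (j ≟F j)) (dec-true (j ≟F j) refl)))
      (λ a a≢j → cong (𝟙 ∘ not)
                      (trans (isYes≗does (j ≟F a)) (dec-false (j ≟F a) (a≢j ∘ sym))))

  starOutDeg-Tv : IsRegularTournament Tn → ∀ t → starOutDeg Tn G (Tv t) ≡ 2 * n
  starOutDeg-Tv regular t = begin
    starOutDeg Tn G (Tv t)
      ≡⟨ sumOver-StarV (𝟙 ∘ star Tn G (Tv t)) ⟩
    sum {n} (λ _ → 0) + (sum {n} (λ _ → 1) + sum (𝟙 ∘ Tn t))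
      ≡⟨ cong₂ (λ z w → z + (w + sum (𝟙 ∘ Tn t)))
               (sum-replicate-zero n) (trans (sum-const n 1) (*-identityʳ n)) ⟩
    n + sum (𝟙 ∘ Tn t)
      ≡⟨ cong (n +_) (outDeg≡∑ Tn t) ⟨
    n + outDeg Tn t
      ≡⟨ cong (n +_) (*-cancelˡ-≡ _ n 2 (regular-tournament-outDeg regular t)) ⟩
    n + n
      ≡⟨ cong (n +_) (+-identityʳ n) ⟨
    2 * n ∎
    where open ≡-Reasoning

  left-of-large-starOutDeg : IsRegularTournament Tn →
                             ∀ x → 2 * n < starOutDeg Tn G x → ∃ λ a → x ≡ L a
  left-of-large-starOutDeg _       (L a)  _     = a , refl
  left-of-large-starOutDeg _       (R j)  large = ⊥-elim (<-asym large (starOutDeg-R j))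
  left-of-large-starOutDeg regular (Tv t) large =
    ⊥-elim (<-irrefl (sym (starOutDeg-Tv regular t)) large)

module _ {n} {Tn : Digraph (Fin (suc (2 * n)))} where
  private
    variable
      G H : Digraph (Fin n)

  star-cong : G ≅ H → star Tn G ≅ star Tn H
  star-cong {G} {H} (φ , φ-hom) = Φ , Φ-hom
    where
    Φ : StarV n ↔ StarV n
    Φ = StarV↔⊎ ↔-∘ ((φ ⊎-↔ (φ ⊎-↔ ↔-id _)) ↔-∘ ↔-sym StarV↔⊎)

    Φ-hom : ∀ x y → star Tn G x y ≡ star Tn H (to Φ x) (to Φ y)
    Φ-hom (L i)  (L j)  = φ-hom i j
    Φ-hom (R i)  (R j)  = φ-hom i j
    Φ-hom (Tv s) (Tv t) = refl
    Φ-hom (L i)  (R j)  = ⌊≟⌋-↔ φ i j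
    Φ-hom (R i)  (L j)  = cong not (⌊≟⌋-↔ φ i j)
    Φ-hom (L i)  (Tv t) = refl
    Φ-hom (Tv t) (R i)  = refl
    Φ-hom (R i)  (Tv t) = refl
    Φ-hom (Tv t) (L i)  = refl

  star-preserves-L : IsRegularTournament Tn → (iso : star Tn G ≅ star Tn H) →
                     ∀ i → ∃ λ a → to (proj₁ iso) (L i) ≡ L a
  star-preserves-L {G} {H} regular iso i =
    left-of-large-starOutDeg Tn H regular (to (proj₁ iso) (L i))
      (subst (2 * n <_) (sym starOutDeg-invariant) (starOutDeg-L Tn G i))
    where
    starOutDeg-invariant : starOutDeg Tn H (to (proj₁ iso) (L i)) ≡ starOutDeg Tn G (L i)
    starOutDeg-invariant =
      outDegree-≅ (enumStarV n) (enumStarV n) {star Tn G} {star Tn H} iso (L i)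

  star-cancel : IsRegularTournament Tn → star Tn G ≅ star Tn H → G ≅ H
  star-cancel {H = H} regular iso@(F , hom) =
    φ , λ i j → trans (hom (L i) (L j)) (cong₂ (star Tn H) (F[L]≡L i) (F[L]≡L j))
    where
    restriction = ↔-restrict F L L L-injective L-injective
                    (star-preserves-L regular iso) (star-preserves-L regular (≅-sym iso))
    φ = proj₁ restriction
    F[L]≡L = proj₂ restriction

lemma12 : (T : (n : ℕ) → Digraph (Fin (suc (2 * n))))
    → (∀ n → 1 ≤ n → IsRegularTournament (T n))
    → (n m : ℕ) → 1 ≤ n → 1 ≤ m
    → (G : Digraph (Fin n)) → (H : Digraph (Fin m))
    → IsDAG G → IsDAG H
    → (G ≅ H) ⇔ (star (T n) G ≅ star (T m) H)
lemma12 T regular n m 1≤n _ G H _ _ = mk⇔ forward backward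
  where
  forward : G ≅ H → star (T n) G ≅ star (T m) H
  forward iso with ↔⇒≡ (proj₁ iso)
  ... | refl = star-cong iso

  backward : star (T n) G ≅ star (T m) H → G ≅ H
  backward iso
    with starSize-injective {n} {m}
           (↔⇒≡ (↔-sym (enumStarV m) ↔-∘ (proj₁ iso ↔-∘ enumStarV n)))
  ... | refl = star-cancel (regular n 1≤n) iso
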